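{- Let $X$ and $Y$ be finite nonempty sets and $F: X\to 2^Y$ a set-valued mapping. For any execution of the calculation method described in the context, the following are equivalent: (i) $F$ satisfies the Hall condition; (ii) the calculation method does not stop at Step 4; (iii) the calculation method stops at Step 7 or at Step 8, and the resulting tuple $(W_1,\ldots,W_m)$ is a Hall partition of $F$.
   Context: A set-valued mapping $F: X \to 2^Y$ assigns to each $x$ a (possibly empty) subset $F(x) \subset Y$; $F(W) = \bigcup_{x\in W}F(x)$; $\sharp$ is cardinality. $F$ satisfies the Hall condition if $\sharp F(W)\ge\sharp W$ for all $W\subset X$. For $W \subset X$, $F_W: X\setminus W \to 2^Y$ is $F_W(x) = F(x) \setminus F(W)$ (with $F_\emptyset = F$). For set-valued $G$ on a finite set, a subset $W$ of its domain is critical for $G$ if $W\ne\emptyset$ and $\sharp G(W)=\sharp W$; non-reducible for $G$ if $W\ne\emptyset$ and no proper subset of $W$ is critical for $G$. A tuple $(W_1,\ldots,W_m)$, $m\ge1$, is a Hall partition of $F$ if the $W_i$ are nonempty, pairwise disjoint with union $X$, and with $G_i = F_{W_1\cup\cdots\cup W_{i-1}}$ ($G_1=F$): (i) $G_i(x)\neq\emptyset$ for $x \in W_i$; (ii) $W_i$ is non-reducible for $G_i$; (iii) $W_i$ is critical for $G_i$ for $i \le m-1$. The calculation method: Step 1: start with $m=0$. Step 2: one has $m\ge 0$ and pairwise disjoint $W_1,\ldots,W_m\subset X$ with $W_i$ critical for $F_{W_1\cup\cdots\cup W_{i-1}}$. Step 3: choose $x \in X\setminus\bigcup_{j\le m}W_j$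 and set $W=\{x\}$. Step 4: if $\sharp F_{\bigcup_{j\le m}W_j}(W) < \sharp W$, STOP; otherwise continue. Step 5: if $W$ is a critical set of $F_{\bigcup_{j\le m}W_j}$, set $W_{m+1}=W$, increase $m$ by one, and go to Step 8; otherwise continue. Step 6: if not all nonempty subsets of $X\setminus\bigcup_{j\le m}W_j$ have yet been considered (in the current pass since Step 3), choose a new one $W'$: one of the same size as $W$ if such a not-yet-considered subset exists, otherwise one with one more element; set $W=W'$ and go to Step 4. Step 7: (all subsets considered, none critical) set $W_{m+1} = X\setminus\bigcup_{j\le m}W_j$, increase $m$ by one, and STOP. Step 8: if $\bigcup_{j\le m}W_j = X$, STOP; otherwise go to Step 2. -}

module Defs where

open import Data.Nat using (ℕ; suc; _≤_; _<_; _<?_; _≟_)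
open import Data.Fin using (Fin; toℕ)
open import Data.Fin.Subset using (Subset; _∈_; _⊆_; _⊂_; _∪_; _∩_; _─_; ∁; ⋃; ∣_∣; Nonempty; Empty; ⊥; ⊤)
open import Data.Fin.Subset.Properties using (_∈?_)
open import Data.List using (List; []; _∷_; map; filter; length; take; lookup)
open import Data.List.Relation.Unary.All using (All)
open import Data.List.Relation.Unary.AllPairs using (AllPairs)
open import Data.List.Membership.Propositional using () renaming (_∈_ to _∈ₗ_)
open import Data.List.Relation.Unary.Unique.Propositional using (Unique)
open import Data.List using (allFin)
open import Data.Product using (_×_)
open import Relation.Nullary using (¬_; yes; no)
open import Relation.Binary.PropositionalEquality using (_≡_)

SetMap : ℕ → ℕ → Set
SetMap n k = Fin n → Subset k

image : ∀ {n k} → SetMap n k → Subset n → Subset k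
image {n} F W = ⋃ (map F (filter (_∈? W) (allFin n)))

Hall : ∀ {n k} → SetMap n k → Set
Hall {n} F = ∀ (W : Subset n) → ∣ W ∣ ≤ ∣ image F W ∣

-- F_U(x) = F(x) \ F(U).  Its domain is X \ U, i.e. ∁ U; the domain is
-- carried separately in the notions below.
restr : ∀ {n k} → SetMap n k → Subset n → SetMap n k
restr F U x = F x ─ image F U

Critical : ∀ {n k} → SetMap n k → Subset n → Subset n → Set
Critical G D W = W ⊆ D × Nonempty W × ∣ image G W ∣ ≡ ∣ W ∣

NonReducible : ∀ {n k} → SetMap n k → Subset n → Subset n → Set
NonReducible G D W = W ⊆ D × Nonempty W × (∀ V → V ⊂ W → ¬ Critical G D V)

Disjoint : ∀ {n} → Subset n → Subset n → Set
Disjoint A B = Empty (A ∩ B)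

HallPartition : ∀ {n k} → SetMap n k → List (Subset n) → Set
HallPartition {n} F Ws =
  1 ≤ length Ws
  × All Nonempty Ws
  × AllPairs Disjoint Ws
  × ⋃ Ws ≡ ⊤
  × (∀ (i : Fin (length Ws)) →
       let U  = ⋃ (take (toℕ i) Ws)
           Gi = restr F U
           Wi = lookup Ws i
       in (∀ x → x ∈ Wi → Nonempty (Gi x))
          × NonReducible Gi (∁ U) Wi
          × (suc (toℕ i) < length Ws → Critical Gi (∁ U) Wi))

-- An admissible order in which a pass (Steps 3–6) examines the subsets
-- of the remaining set X \ U: every nonempty subset of X \ U exactly once,
-- in order of nondecreasing cardinality (so it starts with a singleton {x},
-- x chosen freely, and moves to size+1 only when size is exhausted).
ValidOrder : ∀ {n} → Subset n → List (Subset n) → Set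
ValidOrder {n} U Ws =
  All (λ W → Nonempty W × W ⊆ ∁ U) Ws
  × Unique Ws
  × (∀ (W : Subset n) → Nonempty W → W ⊆ ∁ U → W ∈ₗ Ws)
  × AllPairs (λ A B → ∣ A ∣ ≤ ∣ B ∣) Ws

data PassResult (n : ℕ) : Set where
  deficient : PassResult n               -- STOP at Step 4
  critical  : Subset n → PassResult n    -- Step 5 found a critical set
  none      : PassResult n               -- all subsets considered (Step 7)

-- Run Steps 4–6 of one pass with G = F_U over the given order.
scan : ∀ {n k} → SetMap n k → Subset n → List (Subset n) → PassResult n
scan F U [] = none
scan F U (W ∷ Ws) with ∣ image (restr F U) W ∣ <? ∣ W ∣
... | yes _ = deficient
... | no _ with ∣ image (restr F U) W ∣ ≟ ∣ W ∣
...   | yes _ = critical W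
...   | no _  = scan F U Ws

data StopStep : Set where
  step4 step7 step8 : StopStep

-- Exec F U Ws s : an execution of the method started at Step 2 with
-- W_1 ∪ … ∪ W_m = U produces the further sets Ws (in order) and stops at
-- Step s.
data Exec {n k} (F : SetMap n k) : Subset n → List (Subset n) → StopStep → Set where
  stop4 : ∀ {U Ws} → ValidOrder U Ws → scan F U Ws ≡ deficient →
          Exec F U [] step4
  stop7 : ∀ {U Ws} → ValidOrder U Ws → scan F U Ws ≡ none →
          Exec F U (∁ U ∷ []) step7
  stop8 : ∀ {U Ws W} → ValidOrder U Ws → scan F U Ws ≡ critical W →
          U ∪ W ≡ ⊤ → Exec F U (W ∷ []) step8
  again : ∀ {U Ws W Rest s} → ValidOrder U Ws → scan F U Ws ≡ critical W →
          ¬ (U ∪ W ≡ ⊤) → Exec F (U ∪ W) Rest s → Exec F U (W ∷ Rest) s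

-- A complete execution starts at Step 1 with m = 0 (U = ∅).
Execution : ∀ {n k} → SetMap n k → List (Subset n) → StopStep → Set
Execution F = Exec F ⊥

{-# OPTIONS --safe #-}
-- Write U = W₁ ∪ ⋯ ∪ W_m for the sets found so far.  Two identities drive the
-- argument: ∣F(U ∪ V)∣ = ∣F(U)∣ + ∣F_U(V)∣ and F_{U ∪ W} = (F_U)_W.  Along an
-- execution ∣F(U)∣ = ∣U∣, so a set V that is deficient for F_U at Step 4 makes
-- U ∪ V deficient for F; hence the Hall condition rules out Step 4.
-- Conversely, every other pass shows that F_U satisfies the Hall condition on
-- the block W it produces, strictly on the nonempty proper subsets of W (they
-- are smaller, hence were scanned before W).  Splitting a set V into V ∩ W
-- and V ∖ W glues these inequalities into the Hall condition for F, and the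
-- strict ones make every block non-reducible.
module Submission where

open import Defs
open import Data.Nat using (ℕ; suc; _≤_; _<_; _+_; z≤n; s≤s; _<?_; _≟_)
open import Data.Nat.Base using (s≤s⁻¹)
open import Data.Nat.Properties
  using (≤-refl; ≤-reflexive; ≤-trans; <⇒≤; <-irrefl; +-suc; +-mono-≤; +-monoʳ-<; ≤⇒≯; ≤∧≢⇒<; ≮⇒≥; <-≤-trans; module ≤-Reasoning)
open import Data.Fin using (Fin; toℕ; zero; suc)
open import Data.Fin.Subset
open import Data.Fin.Subset.Properties
open import Data.List using (List; []; _∷_; map; filter; length; take; lookup; allFin)
open import Data.List.Properties using (map-cong)
open import Data.List.Relation.Unary.All as All using (All; []; _∷_)
open import Data.List.Relation.Unary.Any using (Any; here; there)
open import Data.List.Relation.Unary.AllPairs using (AllPairs; []; _∷_)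
open import Data.List.Membership.Propositional using (find; lose) renaming (_∈_ to _∈ₗ_)
open import Data.List.Membership.Propositional.Properties using (∈-allFin; ∈-map⁺; ∈-map⁻; ∈-filter⁺; ∈-filter⁻)
open import Data.Vec using ([]; _∷_; here; there)
open import Data.Product using (_×_; _,_; proj₁; proj₂; ∃)
open import Data.Sum using (_⊎_; inj₁; inj₂; [_,_])
open import Data.Unit using (tt) renaming (⊤ to Unit)
open import Function.Base using (_∘_)
open import Function.Bundles using (_⇔_; mk⇔)
open import Relation.Nullary using (¬_; yes; no; contradiction)
open import Relation.Binary.PropositionalEquality
  using (_≡_; _≢_; refl; sym; trans; cong; cong₂; subst; module ≡-Reasoning)

x∈p─q⇒x∉q : ∀ {n} {x : Fin n} (p q : Subset n) → x ∈ p ─ q → x ∉ q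
x∈p─q⇒x∉q {x = zero}  (_ ∷ p) (outside ∷ q) _         ()
x∈p─q⇒x∉q {x = zero}  (_ ∷ p) (inside ∷ q)  ()        _
x∈p─q⇒x∉q {x = suc x} (_ ∷ p) (_ ∷ q)       (there m) (there m′) = x∈p─q⇒x∉q p q m m′

x∈p⇒⁅x⁆⊆p : ∀ {n} {x : Fin n} {p : Subset n} → x ∈ p → ⁅ x ⁆ ⊆ p
x∈p⇒⁅x⁆⊆p {x = x} x∈p y∈⁅x⁆ = subst (_∈ _) (sym (x∈⁅y⁆⇒x≡y x y∈⁅x⁆)) x∈p

∁p─q⊆∁[p∪q] : ∀ {n} (p q : Subset n) → ∁ p ─ q ⊆ ∁ (p ∪ q)
∁p─q⊆∁[p∪q] p q m = x∉p⇒x∈∁p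
  ([ x∈∁p⇒x∉p (p─q⊆p (∁ p) q m) , x∈p─q⇒x∉q (∁ p) q m ] ∘ x∈p∪q⁻ p q)

p∪q≡⊤⇒∁p⊆q : ∀ {n} {p q : Subset n} → p ∪ q ≡ ⊤ → ∁ p ⊆ q
p∪q≡⊤⇒∁p⊆q {p = p} {q} p∪q≡⊤ {x} x∈∁p with x∈p∪q⁻ p q (subst (x ∈_) (sym p∪q≡⊤) ∈⊤)
... | inj₁ x∈p = contradiction x∈p (x∈∁p⇒x∉p x∈∁p)
... | inj₂ x∈q = x∈q

⊥≢⊤ : ∀ {n} → ⊥ {suc n} ≢ ⊤
⊥≢⊤ ()

∁-nonempty : ∀ {n} {p : Subset n} → p ≢ ⊤ → Nonempty (∁ p)
∁-nonempty {p = p} p≢⊤ with nonempty? (∁ p)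
... | yes ne = ne
... | no ¬ne = contradiction (⊆-antisym ⊆⊤ (λ {x} _ → x∉∁p⇒x∈p (λ m → ¬ne (x , m)))) p≢⊤

⊆⇒≡⊎⊂ : ∀ {n} {p q : Subset n} → p ⊆ q → p ≡ q ⊎ p ⊂ q
⊆⇒≡⊎⊂ {p = []}          {[]}          _ = inj₁ refl
⊆⇒≡⊎⊂ {p = outside ∷ p} {inside ∷ q}  s = inj₂ (out⊂in (drop-∷-⊆ s))
⊆⇒≡⊎⊂ {p = inside ∷ p}  {outside ∷ q} s with () ← s here
⊆⇒≡⊎⊂ {p = outside ∷ p} {outside ∷ q} s with ⊆⇒≡⊎⊂ (drop-∷-⊆ s)
... | inj₁ refl = inj₁ refl
... | inj₂ p⊂q  = inj₂ (s⊂s p⊂q)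
⊆⇒≡⊎⊂ {p = inside ∷ p}  {inside ∷ q}  s with ⊆⇒≡⊎⊂ (drop-∷-⊆ s)
... | inj₁ refl = inj₁ refl
... | inj₂ p⊂q  = inj₂ (s⊂s p⊂q)

disjoint : ∀ {n} {p q : Subset n} → (∀ {x} → x ∈ p → x ∉ q) → Disjoint p q
disjoint {p = p} {q} f (x , m) = let x∈p , x∈q = x∈p∩q⁻ p q m in f x∈p x∈q

Empty⇒∣p∣≡0 : ∀ {n} {p : Subset n} → Empty p → ∣ p ∣ ≡ 0
Empty⇒∣p∣≡0 {n} e = trans (cong ∣_∣ (Empty-unique e)) (∣⊥∣≡0 n)

1≤∣p∣⇒Nonempty : ∀ {n} (p : Subset n) → 1 ≤ ∣ p ∣ → Nonempty p
1≤∣p∣⇒Nonempty p 1≤∣p∣ with nonempty? p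
... | yes ne  = ne
... | no ¬ne with () ← subst (1 ≤_) (Empty⇒∣p∣≡0 ¬ne) 1≤∣p∣

Disjoint⇒∣p∪q∣≡∣p∣+∣q∣ : ∀ {n} (p q : Subset n) → Disjoint p q → ∣ p ∪ q ∣ ≡ ∣ p ∣ + ∣ q ∣
Disjoint⇒∣p∪q∣≡∣p∣+∣q∣ []            []            _ = refl
Disjoint⇒∣p∪q∣≡∣p∣+∣q∣ (outside ∷ p) (outside ∷ q) d = Disjoint⇒∣p∪q∣≡∣p∣+∣q∣ p q (drop-∷-Empty d)
Disjoint⇒∣p∪q∣≡∣p∣+∣q∣ (outside ∷ p) (inside ∷ q)  d =
  trans (cong suc (Disjoint⇒∣p∪q∣≡∣p∣+∣q∣ p q (drop-∷-Empty d))) (sym (+-suc ∣ p ∣ ∣ q ∣))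
Disjoint⇒∣p∪q∣≡∣p∣+∣q∣ (inside ∷ p)  (outside ∷ q) d = cong suc (Disjoint⇒∣p∪q∣≡∣p∣+∣q∣ p q (drop-∷-Empty d))
Disjoint⇒∣p∪q∣≡∣p∣+∣q∣ (inside ∷ p)  (inside ∷ q)  d = contradiction (zero , here) d

q⊆∁p⇒∣p∪q∣≡∣p∣+∣q∣ : ∀ {n} (p q : Subset n) → q ⊆ ∁ p → ∣ p ∪ q ∣ ≡ ∣ p ∣ + ∣ q ∣
q⊆∁p⇒∣p∪q∣≡∣p∣+∣q∣ p q q⊆∁p =
  Disjoint⇒∣p∪q∣≡∣p∣+∣q∣ p q (disjoint λ x∈p x∈q → x∈p⇒x∉∁p x∈p (q⊆∁p x∈q))

∣p∣≡∣p∩q∣+∣p─q∣ : ∀ {n} (p q : Subset n) → ∣ p ∣ ≡ ∣ p ∩ q ∣ + ∣ p ─ q ∣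
∣p∣≡∣p∩q∣+∣p─q∣ []            []            = refl
∣p∣≡∣p∩q∣+∣p─q∣ (outside ∷ p) (inside ∷ q)  = ∣p∣≡∣p∩q∣+∣p─q∣ p q
∣p∣≡∣p∩q∣+∣p─q∣ (outside ∷ p) (outside ∷ q) = ∣p∣≡∣p∩q∣+∣p─q∣ p q
∣p∣≡∣p∩q∣+∣p─q∣ (inside ∷ p)  (inside ∷ q)  = cong suc (∣p∣≡∣p∩q∣+∣p─q∣ p q)
∣p∣≡∣p∩q∣+∣p─q∣ (inside ∷ p)  (outside ∷ q) =
  trans (cong suc (∣p∣≡∣p∩q∣+∣p─q∣ p q)) (sym (+-suc ∣ p ∩ q ∣ ∣ p ─ q ∣))

∈-⋃⁻ : ∀ {n} {x : Fin n} (ps : List (Subset n)) → x ∈ ⋃ ps → Any (x ∈_) ps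
∈-⋃⁻ []       m = contradiction m ∉⊥
∈-⋃⁻ (p ∷ ps) m with x∈p∪q⁻ p (⋃ ps) m
... | inj₁ x∈p  = here x∈p
... | inj₂ x∈ps = there (∈-⋃⁻ ps x∈ps)

∈-⋃⁺ : ∀ {n} {x : Fin n} (ps : List (Subset n)) → Any (x ∈_) ps → x ∈ ⋃ ps
∈-⋃⁺ (p ∷ ps) (here x∈p)  = x∈p∪q⁺ (inj₁ x∈p)
∈-⋃⁺ (p ∷ ps) (there x∈ps) = x∈p∪q⁺ (inj₂ (∈-⋃⁺ ps x∈ps))

module _ {n k : ℕ} where

  ∈-image⁻ : ∀ (G : SetMap n k) {W y} → y ∈ image G W → ∃ λ x → x ∈ W × y ∈ G x
  ∈-image⁻ G {W} y∈GW =
    let A , A∈ , y∈A = find (∈-⋃⁻ _ y∈GW)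
        x , x∈ , A≡Gx = ∈-map⁻ G A∈
    in x , proj₂ (∈-filter⁻ (_∈? W) {xs = allFin n} x∈) , subst (_ ∈_) A≡Gx y∈A

  ∈-image⁺ : ∀ (G : SetMap n k) {W x y} → x ∈ W → y ∈ G x → y ∈ image G W
  ∈-image⁺ G {W} {x} x∈W y∈Gx =
    ∈-⋃⁺ _ (lose (∈-map⁺ G (∈-filter⁺ (_∈? W) (∈-allFin x) x∈W)) y∈Gx)

  image-mono : ∀ {G H : SetMap n k} {V W} → (∀ x → G x ⊆ H x) → V ⊆ W → image G V ⊆ image H W
  image-mono {G} {H} G⊆H V⊆W y∈GV =
    let x , x∈V , y∈Gx = ∈-image⁻ G y∈GV in ∈-image⁺ H (V⊆W x∈V) (G⊆H x y∈Gx)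

  image-cong : ∀ {G H : SetMap n k} → (∀ x → G x ≡ H x) → ∀ W → image G W ≡ image H W
  image-cong G≗H W = cong ⋃ (map-cong G≗H (filter (_∈? W) (allFin n)))

  ∣image-⊥∣ : ∀ (G : SetMap n k) → ∣ image G ⊥ ∣ ≡ ∣ ⊥ {n} ∣
  ∣image-⊥∣ G = trans (Empty⇒∣p∣≡0 λ (y , y∈) → ∉⊥ (proj₁ (proj₂ (∈-image⁻ G y∈)))) (sym (∣⊥∣≡0 n))

  restr-⊆ : ∀ (G : SetMap n k) U x → restr G U x ⊆ G x
  restr-⊆ G U x = p─q⊆p (G x) (image G U)

  restr-anti : ∀ (G : SetMap n k) {U U′} → U ⊆ U′ → ∀ x → restr G U′ x ⊆ restr G U x
  restr-anti G {U} {U′} U⊆U′ x m =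
    x∈p∧x∉q⇒x∈p─q (restr-⊆ G U′ x m)
      (λ y∈GU → x∈p─q⇒x∉q (G x) _ m (image-mono (λ _ → ⊆-refl) U⊆U′ y∈GU))

  image-∪ : ∀ (G : SetMap n k) U V → image G (U ∪ V) ≡ image G U ∪ image (restr G U) V
  image-∪ G U V = ⊆-antisym ⊆ʳ ⊆ˡ
    where
    ⊆ʳ : image G (U ∪ V) ⊆ image G U ∪ image (restr G U) V
    ⊆ʳ {y} y∈ with ∈-image⁻ G y∈ | y ∈? image G U
    ... | _ , _ , _         | yes y∈GU = x∈p∪q⁺ (inj₁ y∈GU)
    ... | x , x∈U∪V , y∈Gx | no y∉GU with x∈p∪q⁻ U V x∈U∪V
    ...   | inj₁ x∈U = contradiction (∈-image⁺ G x∈U y∈Gx) y∉GU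
    ...   | inj₂ x∈V = x∈p∪q⁺ (inj₂ (∈-image⁺ (restr G U) x∈V (x∈p∧x∉q⇒x∈p─q y∈Gx y∉GU)))
    ⊆ˡ : image G U ∪ image (restr G U) V ⊆ image G (U ∪ V)
    ⊆ˡ y∈ with x∈p∪q⁻ (image G U) _ y∈
    ... | inj₁ y∈GU = image-mono (λ _ → ⊆-refl) (p⊆p∪q V) y∈GU
    ... | inj₂ y∈G′V = image-mono (restr-⊆ G U) (q⊆p∪q U V) y∈G′V

  ∣image-∪∣ : ∀ (G : SetMap n k) U V → ∣ image G (U ∪ V) ∣ ≡ ∣ image G U ∣ + ∣ image (restr G U) V ∣
  ∣image-∪∣ G U V = trans (cong ∣_∣ (image-∪ G U V))
    (Disjoint⇒∣p∪q∣≡∣p∣+∣q∣ _ _ (disjoint λ y∈GU y∈ →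
      let x , _ , y∈G′x = ∈-image⁻ (restr G U) y∈ in x∈p─q⇒x∉q (G x) _ y∈G′x y∈GU))

  restr-∪ : ∀ (G : SetMap n k) U W x → restr G (U ∪ W) x ≡ restr (restr G U) W x
  restr-∪ G U W x = begin
    G x ─ image G (U ∪ W)                           ≡⟨ cong (G x ─_) (image-∪ G U W) ⟩
    G x ─ (image G U ∪ image (restr G U) W)         ≡⟨ sym (p─q─r≡p─q∪r (G x) _ _) ⟩
    G x ─ image G U ─ image (restr G U) W           ∎
    where open ≡-Reasoning

-- The Hall condition on the subsets of a set

module _ {n k : ℕ} (G : SetMap n k) where

  HallOn : Subset n → Set
  HallOn W = ∀ V → V ⊆ W → ∣ V ∣ ≤ ∣ image G V ∣

  ProperSurplus : Subset n → Set
  ProperSurplus W = ∀ V → Nonempty V → V ⊂ W → ∣ V ∣ < ∣ image G V ∣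

  hallOn⁺ : ∀ {W} → (∀ V → Nonempty V → V ⊆ W → ∣ V ∣ ≤ ∣ image G V ∣) → HallOn W
  hallOn⁺ h V V⊆W with nonempty? V
  ... | yes ne  = h V ne V⊆W
  ... | no ¬ne = subst (_≤ ∣ image G V ∣) (sym (Empty⇒∣p∣≡0 ¬ne)) z≤n

  hallOn-⊆ : ∀ {W W′} → W′ ⊆ W → HallOn W → HallOn W′
  hallOn-⊆ W′⊆W hall V V⊆W′ = hall V (⊆-trans V⊆W′ W′⊆W)

  properSurplus⇒hallOn : ∀ {W} → ProperSurplus W → ∣ W ∣ ≤ ∣ image G W ∣ → HallOn W
  properSurplus⇒hallOn {W} surplus ∣W∣≤ = hallOn⁺ λ V ne V⊆W → case (⊆⇒≡⊎⊂ V⊆W) ne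
    where
    case : ∀ {V} → V ≡ W ⊎ V ⊂ W → Nonempty V → ∣ V ∣ ≤ ∣ image G V ∣
    case (inj₁ refl) _  = ∣W∣≤
    case (inj₂ V⊂W)  ne = <⇒≤ (surplus _ ne V⊂W)

  hallOn⇒Nonempty : ∀ {W} → HallOn W → ∀ x → x ∈ W → Nonempty (G x)
  hallOn⇒Nonempty hall x x∈W =
    let 1≤∣G⁅x⁆∣ = subst (_≤ ∣ image G ⁅ x ⁆ ∣) (∣⁅x⁆∣≡1 x) (hall ⁅ x ⁆ (x∈p⇒⁅x⁆⊆p x∈W))
        y , y∈G⁅x⁆ = 1≤∣p∣⇒Nonempty _ 1≤∣G⁅x⁆∣
        x′ , x′∈⁅x⁆ , y∈Gx′ = ∈-image⁻ G y∈G⁅x⁆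
    in y , subst (λ z → y ∈ G z) (x∈⁅y⁆⇒x≡y x x′∈⁅x⁆) y∈Gx′

  properSurplus⇒nonReducible : ∀ {D W} → W ⊆ D → Nonempty W → ProperSurplus W → NonReducible G D W
  properSurplus⇒nonReducible W⊆D neW surplus =
    W⊆D , neW , λ V V⊂W (_ , neV , tight) → <-irrefl (sym tight) (surplus V neV V⊂W)

-- The inequality for V ─ W uses G_W ⊆ G_{V ∩ W}, since V ∩ W ⊆ W.
hallOn-glue : ∀ {n k} (G : SetMap n k) {D W} → HallOn G W → HallOn (restr G W) (D ─ W) → HallOn G D
hallOn-glue G {D} {W} hallW hallRest V V⊆D = begin
  ∣ V ∣                                              ≡⟨ ∣p∣≡∣p∩q∣+∣p─q∣ V W ⟩
  ∣ V ∩ W ∣ + ∣ V ─ W ∣                              ≤⟨ +-mono-≤ (hallW _ (p∩q⊆q V W)) (hallRest _ V─W⊆D─W) ⟩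
  ∣ image G (V ∩ W) ∣ + ∣ image (restr G W) (V ─ W) ∣ ≤⟨ +-mono-≤ ≤-refl
                                                          (p⊆q⇒∣p∣≤∣q∣ (image-mono (restr-anti G (p∩q⊆q V W)) ⊆-refl)) ⟩
  ∣ image G (V ∩ W) ∣ + ∣ image (restr G (V ∩ W)) (V ─ W) ∣ ≡⟨ sym (∣image-∪∣ G (V ∩ W) (V ─ W)) ⟩
  ∣ image G ((V ∩ W) ∪ (V ─ W)) ∣                    ≤⟨ p⊆q⇒∣p∣≤∣q∣ (image-mono (λ _ → ⊆-refl) V∩W∪V─W⊆V) ⟩
  ∣ image G V ∣                                      ∎
  where
  open ≤-Reasoning
  V─W⊆D─W : V ─ W ⊆ D ─ W
  V─W⊆D─W m = x∈p∧x∉q⇒x∈p─q (V⊆D (p─q⊆p V W m)) (x∈p─q⇒x∉q V W m)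
  V∩W∪V─W⊆V : (V ∩ W) ∪ (V ─ W) ⊆ V
  V∩W∪V─W⊆V m = [ p∩q⊆p V W , p─q⊆p V W ] (x∈p∪q⁻ _ _ m)

hallOn-restr-∪ : ∀ {n k} (G : SetMap n k) U W {D} → HallOn (restr G (U ∪ W)) D → HallOn (restr (restr G U) W) D
hallOn-restr-∪ G U W hall V V⊆D = subst (∣ V ∣ ≤_) (cong ∣_∣ (image-cong (restr-∪ G U W) V)) (hall V V⊆D)

HallBlock : ∀ {n k} → SetMap n k → Subset n → Subset n → Set → Set
HallBlock G D W P = (∀ x → x ∈ W → Nonempty (G x)) × NonReducible G D W × (P → Critical G D W)

hallBlock : ∀ {n k} (G : SetMap n k) {D W P} → W ⊆ D → Nonempty W → ∣ W ∣ ≤ ∣ image G W ∣ →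
            ProperSurplus G W → (P → Critical G D W) → HallBlock G D W P
hallBlock G W⊆D neW ∣W∣≤ surplus isCritical =
  hallOn⇒Nonempty G (properSurplus⇒hallOn G surplus ∣W∣≤) ,
  properSurplus⇒nonReducible G W⊆D neW surplus ,
  isCritical

hallBlock-map : ∀ {n k} {G : SetMap n k} {D W P P′} → (P′ → P) → HallBlock G D W P → HallBlock G D W P′
hallBlock-map f (values , nonReducible , isCritical) = values , nonReducible , λ p′ → isCritical (f p′)

-- The side condition 1 ≤ length Ws says that W is not the last block.
Blocks : ∀ {n k} → SetMap n k → Subset n → List (Subset n) → Set
Blocks F U []       = Unit
Blocks F U (W ∷ Ws) = HallBlock (restr F U) (∁ U) W (1 ≤ length Ws) × Blocks F (U ∪ W) Ws

blocks-lookup : ∀ {n k} (F : SetMap n k) U Ws → Blocks F U Ws → (i : Fin (length Ws)) →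
                let U′ = U ∪ ⋃ (take (toℕ i) Ws)
                in HallBlock (restr F U′) (∁ U′) (lookup Ws i) (suc (toℕ i) < length Ws)
blocks-lookup F U (W ∷ Ws) (block , _) zero =
  subst (λ U′ → HallBlock (restr F U′) (∁ U′) W _) (sym (∪-identityʳ U)) (hallBlock-map s≤s⁻¹ block)
blocks-lookup F U (W ∷ Ws) (_ , blocks) (suc i) =
  subst (λ U′ → HallBlock (restr F U′) (∁ U′) (lookup Ws i) _) (∪-assoc U W (⋃ (take (toℕ i) Ws)))
    (hallBlock-map s≤s⁻¹ (blocks-lookup F (U ∪ W) Ws blocks i))

-- One pass of the method

module Pass {n k : ℕ} (F : SetMap n k) (U : Subset n) where

  private
    G : SetMap n k
    G = restr F U

  scan-deficient : ∀ Ws → scan F U Ws ≡ deficient → ∃ λ V → V ∈ₗ Ws × ∣ image G V ∣ < ∣ V ∣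
  scan-deficient (W ∷ Ws) eq with ∣ image G W ∣ <? ∣ W ∣
  ... | yes def = W , here refl , def
  ... | no _ with ∣ image G W ∣ ≟ ∣ W ∣
  scan-deficient (W ∷ Ws) () | no _ | yes _
  scan-deficient (W ∷ Ws) eq | no _ | no _ =
    let V , V∈ , def = scan-deficient Ws eq in V , there V∈ , def

  scan-none : ∀ Ws → scan F U Ws ≡ none → All (λ V → ∣ V ∣ < ∣ image G V ∣) Ws
  scan-none []       _  = []
  scan-none (W ∷ Ws) eq with ∣ image G W ∣ <? ∣ W ∣
  scan-none (W ∷ Ws) () | yes _
  ... | no ≮ with ∣ image G W ∣ ≟ ∣ W ∣
  scan-none (W ∷ Ws) () | no _ | yes _
  scan-none (W ∷ Ws) eq | no ≮ | no ≢ = ≤∧≢⇒< (≮⇒≥ ≮) (λ e → ≢ (sym e)) ∷ scan-none Ws eq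

  -- The scan stops at the first critical set, and all later sets are at least as large.
  scan-critical : ∀ Ws {W} → AllPairs (λ A B → ∣ A ∣ ≤ ∣ B ∣) Ws → scan F U Ws ≡ critical W →
                  W ∈ₗ Ws × ∣ image G W ∣ ≡ ∣ W ∣ × (∀ V → V ∈ₗ Ws → ∣ V ∣ < ∣ W ∣ → ∣ V ∣ < ∣ image G V ∣)
  scan-critical (W′ ∷ Ws) (sizes ∷ _) eq with ∣ image G W′ ∣ <? ∣ W′ ∣
  scan-critical (W′ ∷ Ws) (sizes ∷ _) () | yes _
  ... | no ≮ with ∣ image G W′ ∣ ≟ ∣ W′ ∣
  scan-critical (W′ ∷ Ws) (sizes ∷ _) refl | no _ | yes tight = here refl , tight , smaller
    where
    smaller : ∀ V → V ∈ₗ W′ ∷ Ws → ∣ V ∣ < ∣ W′ ∣ → ∣ V ∣ < ∣ image G V ∣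
    smaller V (here refl) lt = contradiction lt (<-irrefl refl)
    smaller V (there V∈)  lt = contradiction (<-≤-trans lt (All.lookup sizes V∈)) (<-irrefl refl)
  scan-critical (W′ ∷ Ws) (_ ∷ sorted) eq | no ≮ | no ≢ =
    let W∈ , tight , smaller = scan-critical Ws sorted eq
    in there W∈ , tight , λ where
      V (here refl) _ → ≤∧≢⇒< (≮⇒≥ ≮) (λ e → ≢ (sym e))
      V (there V∈)  lt → smaller V V∈ lt

  pass-deficient : ∀ {Ws} → ValidOrder U Ws → scan F U Ws ≡ deficient →
                   ∃ λ V → V ⊆ ∁ U × ∣ image G V ∣ < ∣ V ∣
  pass-deficient {Ws} (admissible , _) eq =
    let V , V∈ , def = scan-deficient Ws eq in V , proj₂ (All.lookup admissible V∈) , def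

  pass-none : ∀ {Ws} → ValidOrder U Ws → scan F U Ws ≡ none →
              ∀ V → Nonempty V → V ⊆ ∁ U → ∣ V ∣ < ∣ image G V ∣
  pass-none {Ws} (_ , _ , complete , _) eq V ne V⊆ = All.lookup (scan-none Ws eq) (complete V ne V⊆)

  pass-critical : ∀ {Ws W} → ValidOrder U Ws → scan F U Ws ≡ critical W →
                  Critical G (∁ U) W × ProperSurplus G W
  pass-critical {Ws} (admissible , _ , complete , sorted) eq =
    let W∈ , tight , smaller = scan-critical Ws sorted eq
        ne , W⊆ = All.lookup admissible W∈
    in (W⊆ , ne , tight) ,
       λ V neV V⊂W → smaller V (complete V neV (⊆-trans (p⊂q⇒p⊆q V⊂W) W⊆)) (p⊂q⇒∣p∣<∣q∣ V⊂W)

  pass-none⇒hallOn : ∀ {Ws} → ValidOrder U Ws → scan F U Ws ≡ none → HallOn G (∁ U)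
  pass-none⇒hallOn vo eq = hallOn⁺ G λ V ne V⊆ → <⇒≤ (pass-none vo eq V ne V⊆)

  pass-critical⇒hallOn : ∀ {Ws W} → ValidOrder U Ws → scan F U Ws ≡ critical W → HallOn G W
  pass-critical⇒hallOn vo eq =
    let (_ , _ , tight) , surplus = pass-critical vo eq
    in properSurplus⇒hallOn G surplus (≤-reflexive (sym tight))

  pass-none⇒hallBlock : ∀ {Ws P} → ValidOrder U Ws → scan F U Ws ≡ none → U ≢ ⊤ → ¬ P →
                        HallBlock G (∁ U) (∁ U) P
  pass-none⇒hallBlock vo eq U≢⊤ ¬P =
    hallBlock G ⊆-refl (∁-nonempty U≢⊤) (pass-none⇒hallOn vo eq _ ⊆-refl)
      (λ V ne V⊂ → pass-none vo eq V ne (p⊂q⇒p⊆q V⊂)) (λ p → contradiction p ¬P)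

  pass-critical⇒hallBlock : ∀ {Ws W P} → ValidOrder U Ws → scan F U Ws ≡ critical W →
                            HallBlock G (∁ U) W P
  pass-critical⇒hallBlock vo eq =
    let isCritical@(W⊆ , ne , tight) , surplus = pass-critical vo eq
    in hallBlock G W⊆ ne (≤-reflexive (sym tight)) surplus (λ _ → isCritical)

open Pass

-- Executions

module _ {n k : ℕ} (F : SetMap n k) where

  critical-∪ : ∀ {U W} → ∣ image F U ∣ ≡ ∣ U ∣ → Critical (restr F U) (∁ U) W →
               ∣ image F (U ∪ W) ∣ ≡ ∣ U ∪ W ∣
  critical-∪ {U} {W} tightU (W⊆ , _ , tightW) = begin
    ∣ image F (U ∪ W) ∣                      ≡⟨ ∣image-∪∣ F U W ⟩
    ∣ image F U ∣ + ∣ image (restr F U) W ∣  ≡⟨ cong₂ _+_ tightU tightW ⟩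
    ∣ U ∣ + ∣ W ∣                            ≡⟨ sym (q⊆∁p⇒∣p∪q∣≡∣p∣+∣q∣ U W W⊆) ⟩
    ∣ U ∪ W ∣                                ∎
    where open ≡-Reasoning

  deficient-∪ : ∀ {U V} → ∣ image F U ∣ ≡ ∣ U ∣ → V ⊆ ∁ U → ∣ image (restr F U) V ∣ < ∣ V ∣ →
                ∣ image F (U ∪ V) ∣ < ∣ U ∪ V ∣
  deficient-∪ {U} {V} tightU V⊆ def = begin-strict
    ∣ image F (U ∪ V) ∣                      ≡⟨ ∣image-∪∣ F U V ⟩
    ∣ image F U ∣ + ∣ image (restr F U) V ∣  ≡⟨ cong (_+ ∣ image (restr F U) V ∣) tightU ⟩
    ∣ U ∣ + ∣ image (restr F U) V ∣          <⟨ +-monoʳ-< ∣ U ∣ def ⟩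
    ∣ U ∣ + ∣ V ∣                            ≡⟨ sym (q⊆∁p⇒∣p∪q∣≡∣p∣+∣q∣ U V V⊆) ⟩
    ∣ U ∪ V ∣                                ∎
    where open ≤-Reasoning

  hall⇒¬step4 : Hall F → ∀ {U Ws s} → ∣ image F U ∣ ≡ ∣ U ∣ → Exec F U Ws s → s ≢ step4
  hall⇒¬step4 hall {U} tightU (stop4 vo eq) _ =
    let V , V⊆ , def = pass-deficient F U vo eq
    in ≤⇒≯ (hall (U ∪ V)) (deficient-∪ tightU V⊆ def)
  hall⇒¬step4 hall tightU (stop7 _ _) ()
  hall⇒¬step4 hall tightU (stop8 _ _ _) ()
  hall⇒¬step4 hall tightU (again vo eq _ ex) =
    hall⇒¬step4 hall (critical-∪ tightU (proj₁ (pass-critical F _ vo eq))) ex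

  exec-hallOn : ∀ {U Ws s} → Exec F U Ws s → s ≢ step4 → HallOn (restr F U) (∁ U)
  exec-hallOn (stop4 _ _) ¬4 = contradiction refl ¬4
  exec-hallOn {U} (stop7 vo eq) _ = pass-none⇒hallOn F U vo eq
  exec-hallOn {U} (stop8 vo eq U∪W≡⊤) _ =
    hallOn-⊆ (restr F U) (p∪q≡⊤⇒∁p⊆q U∪W≡⊤) (pass-critical⇒hallOn F U vo eq)
  exec-hallOn {U} (again {W = W} vo eq _ ex) ¬4 =
    hallOn-glue (restr F U) (pass-critical⇒hallOn F U vo eq)
      (hallOn-⊆ _ (∁p─q⊆∁[p∪q] U W) (hallOn-restr-∪ F U W (exec-hallOn ex ¬4)))

  exec-⊆∁ : ∀ {U Ws s} → Exec F U Ws s → All (_⊆ ∁ U) Ws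
  exec-⊆∁ (stop4 _ _)   = []
  exec-⊆∁ (stop7 _ _)   = ⊆-refl ∷ []
  exec-⊆∁ {U} (stop8 vo eq _) = proj₁ (proj₁ (pass-critical F U vo eq)) ∷ []
  exec-⊆∁ {U} (again {W = W} vo eq _ ex) =
    proj₁ (proj₁ (pass-critical F U vo eq)) ∷
    All.map (λ R⊆ {_} m → p⊆q⇒∁p⊇∁q (p⊆p∪q W) (R⊆ m)) (exec-⊆∁ ex)

  exec-disjoint : ∀ {U Ws s} → Exec F U Ws s → AllPairs Disjoint Ws
  exec-disjoint (stop4 _ _)   = []
  exec-disjoint (stop7 _ _)   = [] ∷ []
  exec-disjoint (stop8 _ _ _) = [] ∷ []
  exec-disjoint {U} (again {W = W} _ _ _ ex) =
    All.map (λ R⊆ → disjoint λ x∈W x∈R → x∈p⇒x∉∁p (q⊆p∪q U W x∈W) (R⊆ x∈R)) (exec-⊆∁ ex) ∷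
    exec-disjoint ex

  exec-nonempty : ∀ {U Ws s} → U ≢ ⊤ → Exec F U Ws s → All Nonempty Ws
  exec-nonempty _   (stop4 _ _)        = []
  exec-nonempty U≢⊤ (stop7 _ _)        = ∁-nonempty U≢⊤ ∷ []
  exec-nonempty {U} _ (stop8 vo eq _) = proj₁ (proj₂ (proj₁ (pass-critical F U vo eq))) ∷ []
  exec-nonempty {U} _ (again vo eq U∪W≢⊤ ex) =
    proj₁ (proj₂ (proj₁ (pass-critical F U vo eq))) ∷ exec-nonempty U∪W≢⊤ ex

  exec-covers : ∀ {U Ws s} → Exec F U Ws s → s ≢ step4 → U ∪ ⋃ Ws ≡ ⊤
  exec-covers (stop4 _ _) ¬4 = contradiction refl ¬4
  exec-covers {U} (stop7 _ _) _ = trans (cong (U ∪_) (∪-identityʳ (∁ U))) (p∪∁p≡⊤ U)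
  exec-covers {U} (stop8 {W = W} _ _ U∪W≡⊤) _ = trans (cong (U ∪_) (∪-identityʳ W)) U∪W≡⊤
  exec-covers {U} (again {W = W} {Rest} _ _ _ ex) ¬4 =
    trans (sym (∪-assoc U W (⋃ Rest))) (exec-covers ex ¬4)

  exec-length : ∀ {U Ws s} → Exec F U Ws s → s ≢ step4 → 1 ≤ length Ws
  exec-length (stop4 _ _)     ¬4 = contradiction refl ¬4
  exec-length (stop7 _ _)     _  = s≤s z≤n
  exec-length (stop8 _ _ _)   _  = s≤s z≤n
  exec-length (again _ _ _ _) _  = s≤s z≤n

  exec-blocks : ∀ {U Ws s} → U ≢ ⊤ → Exec F U Ws s → Blocks F U Ws
  exec-blocks _ (stop4 _ _) = tt
  exec-blocks {U} U≢⊤ (stop7 vo eq) = pass-none⇒hallBlock F U vo eq U≢⊤ (λ ()) , tt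
  exec-blocks {U} _ (stop8 vo eq _) = pass-critical⇒hallBlock F U vo eq , tt
  exec-blocks {U} _ (again vo eq U∪W≢⊤ ex) = pass-critical⇒hallBlock F U vo eq , exec-blocks U∪W≢⊤ ex

module _ {n k : ℕ} (F : SetMap (suc n) k) {Ws : List (Subset (suc n))} {s : StopStep} where

  execution-hall : Execution F Ws s → s ≢ step4 → Hall F
  execution-hall ex ¬4 W =
    ≤-trans (exec-hallOn F ex ¬4 W (λ _ → x∉p⇒x∈∁p ∉⊥))
            (p⊆q⇒∣p∣≤∣q∣ (image-mono {V = W} (restr-⊆ F ⊥) ⊆-refl))

  execution-hallPartition : Execution F Ws s → s ≢ step4 → HallPartition F Ws
  execution-hallPartition ex ¬4 =
    exec-length F ex ¬4 ,
    exec-nonempty F ⊥≢⊤ ex ,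
    exec-disjoint F ex ,
    trans (sym (∪-identityˡ (⋃ Ws))) (exec-covers F ex ¬4) ,
    λ i → subst (λ U → HallBlock (restr F U) (∁ U) (lookup Ws i) (suc (toℕ i) < length Ws))
                (∪-identityˡ _) (blocks-lookup F ⊥ Ws (exec-blocks F ⊥≢⊤ ex) i)

¬step4⇒step7⊎step8 : ∀ {s} → s ≢ step4 → s ≡ step7 ⊎ s ≡ step8
¬step4⇒step7⊎step8 {step4} ¬4 = contradiction refl ¬4
¬step4⇒step7⊎step8 {step7} _  = inj₁ refl
¬step4⇒step7⊎step8 {step8} _  = inj₂ refl

step7⊎step8⇒¬step4 : ∀ {s} → s ≡ step7 ⊎ s ≡ step8 → s ≢ step4
step7⊎step8⇒¬step4 (inj₁ refl) ()
step7⊎step8⇒¬step4 (inj₂ refl) ()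

theorem8p1 : ∀ (n k : ℕ) (F : SetMap (suc n) (suc k))
               (Ws : List (Subset (suc n))) (s : StopStep) →
               Execution F Ws s →
               (Hall F ⇔ (¬ (s ≡ step4)))
               × ((¬ (s ≡ step4)) ⇔ ((s ≡ step7 ⊎ s ≡ step8) × HallPartition F Ws))
theorem8p1 n k F Ws s ex =
  mk⇔ (λ hall → hall⇒¬step4 F hall (∣image-⊥∣ F) ex) (execution-hall F ex) ,
  mk⇔ (λ ¬4 → ¬step4⇒step7⊎step8 ¬4 , execution-hallPartition F ex ¬4)
      (λ (stops , _) → step7⊎step8⇒¬step4 stops)
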